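{- Let $p$ be an odd prime and $k$ a positive integer. Let $0\le m,n\le p^k-1$ with base-$p$ expansions $m=\sum_{j=0}^{k-1}m_jp^j$, $n=\sum_{j=0}^{k-1}n_jp^j$, $m_j,n_j\in\{0,\dots,p-1\}$. Then $\Phi_{0,p}^k(A)[m,n]\neq0$ if and only if $m_j\equiv n_j\pmod 2$ for every $j=0,1,\dots,k-1$.
   Context: $\Phi_{0,p}$ is the two-dimensional $[p,p]$-morphism on the alphabet $\{0,A\}$: it sends $0$ to the $p\times p$ all-$0$ array and $A$ to the $p\times p$ array whose entry in row $m$, column $n$ ($0\le m,n\le p-1$) is $A$ if $m\equiv n\pmod 2$ and $0$ otherwise; an array of letters is mapped to the block array obtained by replacing each letter by its image. $\Phi_{0,p}^k(A)$ is the $p^k\times p^k$ array obtained by applying $\Phi_{0,p}$ $k$ times to the single letter $A$, and $\Phi_{0,p}^k(A)[m,n]$ denotes its entry in row $m$, column $n$; "$\neq0$" means the entry is $A$. -}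

module Defs where

open import Data.Nat using (ℕ; zero; suc; _*_; _^_; _/_; _%_; _<_; _≟_; NonZero)
open import Data.Nat.Properties using (*-comm; m^n≢0)
open import Data.Fin using (Fin; toℕ; fromℕ<; remQuot; cast)
open import Data.Product using (_,_)
open import Relation.Nullary using (yes; no)
open import Relation.Binary.PropositionalEquality using (_≡_; refl; cong; trans)

-- The two-letter alphabet {0, A}; the letter 0 is written O.
data Letter : Set where
  O A : Letter

Array : ℕ → ℕ → Set
Array r c = Fin r → Fin c → Letter

φ : (p : ℕ) → Letter → Array p p
φ p O m n = O
φ p A m n with toℕ m % 2 ≟ toℕ n % 2
... | yes _ = A
... | no  _ = O

-- Φ_{0,p} on an s × s array: replace each letter by its p × p image.
-- Row index i ∈ Fin (s * p) splits as (block row, row within block).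
Φ : (p : ℕ) {s : ℕ} → Array s s → Array (s * p) (s * p)
Φ p {s} X i j with remQuot {s} p i | remQuot {s} p j
... | (bi , ri) | (bj , rj) = φ p (X bi bj) ri rj

-- p^k as p^(k-1) * p, matching the size produced by iterating Φ.
size : ℕ → ℕ → ℕ
size p zero    = 1
size p (suc k) = size p k * p

size≡ : (p k : ℕ) → size p k ≡ p ^ k
size≡ p zero    = refl
size≡ p (suc k) = trans (cong (_* p) (size≡ p k)) (*-comm (p ^ k) p)

Φiter : (p k : ℕ) → Array (size p k) (size p k)
Φiter p zero    _ _ = A
Φiter p (suc k) = Φ p (Φiter p k)

Φpow : (p k : ℕ) → Array (p ^ k) (p ^ k)
Φpow p k i j = Φiter p k (cast (sym' (size≡ p k)) i) (cast (sym' (size≡ p k)) j)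
  where
    sym' : ∀ {a b : ℕ} → a ≡ b → b ≡ a
    sym' refl = refl

entry : (p k m n : ℕ) → m < p ^ k → n < p ^ k → Letter
entry p k m n m< n< = Φpow p k (fromℕ< m<) (fromℕ< n<)

digit : (p : ℕ) .{{_ : NonZero p}} → ℕ → ℕ → ℕ
digit p m j = (_/_ m (p ^ j) {{m^n≢0 p j}}) % p

-- Φ^(k+1)(A) = Φ(Φ^k(A)), and entry (m, n) of Φ(X) sits in block (m / p, n / p) at position
-- (m % p, n % p), so it is A exactly when X[m / p, n / p] = A and m % p ≡ n % p (mod 2).
-- Induction on k therefore peels off one base-p digit at a time.
module Submission where

open import Defs
open import Data.Nat using (ℕ; zero; suc; _+_; _*_; _/_; _%_; _^_; _<_; _≟_; z<s; s<s; NonZero)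
open import Data.Nat.Properties using (*-comm; +-identityʳ; m^n≢0)
open import Data.Nat.DivMod
  using (+-distrib-/-∣ˡ; %-remove-+ˡ; m*n/n≡m; m<n⇒m/n≡0; m<n⇒m%n≡m; n/1≡n; m/n/o≡m/[n*o])
open import Data.Nat.Divisibility using (_∣_; m∣m*n)
open import Data.Nat.Primality using (Prime)
open import Data.Fin using (Fin; toℕ; fromℕ<; quotient; remainder)
open import Data.Fin.Properties using (toℕ-combine; combine-remQuot; toℕ-cast; toℕ-fromℕ<; toℕ<n)
open import Data.Product using (_×_; _,_)
open import Data.Product.Function.NonDependent.Propositional using (_×-⇔_)
open import Data.Empty using (⊥-elim)
open import Function.Base using (id)
open import Function.Bundles using (_⇔_; mk⇔)
open import Function.Construct.Identity using (⇔-id)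
open import Function.Properties.Equivalence using (⇔-setoid)
open import Level using (0ℓ)
open import Relation.Nullary using (¬_; yes; no)
open import Relation.Binary.PropositionalEquality
  using (_≡_; _≢_; refl; sym; trans; cong; cong₂; subst; subst₂; module ≡-Reasoning)
import Relation.Binary.Reasoning.Setoid as SetoidReasoning

module ⇔-Reasoning = SetoidReasoning (⇔-setoid 0ℓ)

SameParity : ℕ → ℕ → Set
SameParity a b = a % 2 ≡ b % 2

≢O⇔≡A : {x : Letter} → x ≢ O ⇔ x ≡ A
≢O⇔≡A {O} = mk⇔ (λ x≢O → ⊥-elim (x≢O refl)) (λ ())
≢O⇔≡A {A} = mk⇔ (λ _ → refl) (λ _ ())

φ-≡A⇔ : ∀ p x (r s : Fin p) → φ p x r s ≡ A ⇔ (x ≡ A × SameParity (toℕ r) (toℕ s))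
φ-≡A⇔ p O r s = mk⇔ (λ ()) (λ { (() , _) })
φ-≡A⇔ p A r s with toℕ r % 2 ≟ toℕ s % 2
... | yes r≡s = mk⇔ (λ _ → refl , r≡s) (λ _ → refl)
... | no  r≢s = mk⇔ (λ ()) (λ (_ , r≡s) → ⊥-elim (r≢s r≡s))

module _ (p : ℕ) .{{_ : NonZero p}} where

  [p*q+r]/p≡q : ∀ q {r} → r < p → (p * q + r) / p ≡ q
  [p*q+r]/p≡q q {r} r<p = begin
    (p * q + r) / p    ≡⟨ +-distrib-/-∣ˡ r (m∣m*n q) ⟩
    p * q / p + r / p  ≡⟨ cong₂ _+_ (trans (cong (_/ p) (*-comm p q)) (m*n/n≡m q p))
                                   (m<n⇒m/n≡0 r<p) ⟩
    q + 0              ≡⟨ +-identityʳ q ⟩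
    q                  ∎
    where open ≡-Reasoning

  [p*q+r]%p≡r : ∀ q {r} → r < p → (p * q + r) % p ≡ r
  [p*q+r]%p≡r q {r} r<p = trans (%-remove-+ˡ r (m∣m*n q)) (m<n⇒m%n≡m r<p)

  toℕ≡p*quotient+remainder : ∀ {s} (i : Fin (s * p)) →
                              toℕ i ≡ p * toℕ (quotient {s} p i) + toℕ (remainder {s} p i)
  toℕ≡p*quotient+remainder {s} i =
    trans (cong toℕ (sym (combine-remQuot {s} p i)))
          (toℕ-combine (quotient {s} p i) (remainder {s} p i))

  toℕ-quotient : ∀ {s} (i : Fin (s * p)) → toℕ (quotient {s} p i) ≡ toℕ i / p
  toℕ-quotient {s} i = sym (trans (cong (_/ p) (toℕ≡p*quotient+remainder i))
                                  ([p*q+r]/p≡q _ (toℕ<n (remainder {s} p i))))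

  toℕ-remainder : ∀ {s} (i : Fin (s * p)) → toℕ (remainder {s} p i) ≡ toℕ i % p
  toℕ-remainder {s} i = sym (trans (cong (_% p) (toℕ≡p*quotient+remainder i))
                                   ([p*q+r]%p≡r (toℕ (quotient {s} p i)) (toℕ<n _)))

  digit-zero : ∀ m → digit p m 0 ≡ m % p
  digit-zero m = cong (_% p) (n/1≡n m)

  digit-suc : ∀ m j → digit p m (suc j) ≡ digit p (m / p) j
  digit-suc m j =
    cong (_% p) (sym (m/n/o≡m/[n*o] m p (p ^ j) {{_}} {{m^n≢0 p j}} {{m^n≢0 p (suc j)}}))

  DigitParitiesAgree : ℕ → ℕ → ℕ → Set
  DigitParitiesAgree k m n = (j : ℕ) → j < k → SameParity (digit p m j) (digit p n j)

  DigitParitiesAgree-suc : ∀ k m n →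
    DigitParitiesAgree (suc k) m n
      ⇔ (DigitParitiesAgree k (m / p) (n / p) × SameParity (m % p) (n % p))
  DigitParitiesAgree-suc k m n = mk⇔
    (λ agree → (λ j j<k → subst id (lowerDigits j) (agree (suc j) (s<s j<k)))
              , subst id lowestDigit (agree 0 z<s))
    (λ where (_     , lowest) zero    _         → subst id (sym lowestDigit) lowest
             (lower , _)      (suc j) (s<s j<k) → subst id (sym (lowerDigits j)) (lower j j<k))
    where
    lowestDigit : SameParity (digit p m 0) (digit p n 0) ≡ SameParity (m % p) (n % p)
    lowestDigit = cong₂ SameParity (digit-zero m) (digit-zero n)

    lowerDigits : ∀ j → SameParity (digit p m (suc j)) (digit p n (suc j))
                      ≡ SameParity (digit p (m / p) j) (digit p (n / p) j)
    lowerDigits j = cong₂ SameParity (digit-suc m j) (digit-suc n j)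

  Φiter-≡A⇔ : ∀ k (i j : Fin (size p k)) →
              Φiter p k i j ≡ A ⇔ DigitParitiesAgree k (toℕ i) (toℕ j)
  Φiter-≡A⇔ zero    i j = mk⇔ (λ _ _ ()) (λ _ → refl)
  Φiter-≡A⇔ (suc k) i j = begin
    Φiter p (suc k) i j ≡ A
      -- Φ matches on the pairs remQuot p i and remQuot p j, which reduces by η.
      ≈⟨ φ-≡A⇔ p (Φiter p k qi qj) ri rj ⟩
    (Φiter p k qi qj ≡ A × SameParity (toℕ ri) (toℕ rj))
      ≈⟨ Φiter-≡A⇔ k qi qj ×-⇔ ⇔-id _ ⟩
    (DigitParitiesAgree k (toℕ qi) (toℕ qj) × SameParity (toℕ ri) (toℕ rj))
      ≡⟨ cong₂ _×_
           (cong₂ (DigitParitiesAgree k) (toℕ-quotient {size p k} i) (toℕ-quotient {size p k} j))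
           (cong₂ SameParity (toℕ-remainder {size p k} i) (toℕ-remainder {size p k} j)) ⟩
    (DigitParitiesAgree k (toℕ i / p) (toℕ j / p) × SameParity (toℕ i % p) (toℕ j % p))
      ≈⟨ DigitParitiesAgree-suc k (toℕ i) (toℕ j) ⟨
    DigitParitiesAgree (suc k) (toℕ i) (toℕ j) ∎
    where
    open ⇔-Reasoning
    qi = quotient {size p k} p i
    qj = quotient {size p k} p j
    ri = remainder {size p k} p i
    rj = remainder {size p k} p j

  Φpow-≡A⇔ : ∀ k (i j : Fin (p ^ k)) →
             Φpow p k i j ≡ A ⇔ DigitParitiesAgree k (toℕ i) (toℕ j)
  Φpow-≡A⇔ k i j = subst₂ (λ a b → Φpow p k i j ≡ A ⇔ DigitParitiesAgree k a b)
                          (toℕ-cast _ i) (toℕ-cast _ j) (Φiter-≡A⇔ k _ _)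

lemma6p2 : (p : ℕ) .{{_ : NonZero p}} → Prime p → ¬ (2 ∣ p) →
           (k : ℕ) → 0 < k →
           (m n : ℕ) → (m< : m < p ^ k) → (n< : n < p ^ k) →
           (entry p k m n m< n< ≢ O) ⇔
           ((j : ℕ) → j < k → digit p m j % 2 ≡ digit p n j % 2)
lemma6p2 p _ _ k _ m n m< n< = begin
  entry p k m n m< n< ≢ O
    ≈⟨ ≢O⇔≡A ⟩
  entry p k m n m< n< ≡ A
    ≈⟨ Φpow-≡A⇔ p k (fromℕ< m<) (fromℕ< n<) ⟩
  DigitParitiesAgree p k (toℕ (fromℕ< m<)) (toℕ (fromℕ< n<))
    ≡⟨ cong₂ (DigitParitiesAgree p k) (toℕ-fromℕ< m<) (toℕ-fromℕ< n<) ⟩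
  DigitParitiesAgree p k m n ∎
  where open ⇔-Reasoning
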